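{- Let $G=(V,E)$ be a finite graph with orientation $\varepsilon$, $q$ a positive integer, and $f_1,f_2\in F(G,\varepsilon;q)$. If $f_1(e)\equiv f_2(e)\pmod q$ for all $e\in E$, then $\varepsilon_{f_1}$ and $\varepsilon_{f_2}$ are Eulerian equivalent.
   Context: Orientations assign directions to edges; $\varepsilon(v,e)=\pm1$ according as $e$ leaves/enters its end-vertex $v$ (loops contribute $0$ in vertex sums). $F(G,\varepsilon;q)=\{f:E\to\mathbb R:\ \sum_e\varepsilon(v,e)f(e)=0\ \forall v\in V,\ |f(e)|<q\ \forall e\}$ (real $q$-flows). For $f:E\to\mathbb R$, $\varepsilon_f$ is the orientation that agrees with $\varepsilon$ on edges with $f(e)>0$ and reverses $\varepsilon$ on edges with $f(e)\le0$. Two orientations $\varepsilon_1,\varepsilon_2$ are Eulerian equivalent if the spanning subgraph on the edges to which they give opposite directions, oriented by $\varepsilon_1$, is directed Eulerian (in-degree equals out-degree at every vertex). -}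

module Defs where

open import Level using (Level; _⊔_)
open import Data.Nat as ℕ using (ℕ)
open import Data.Integer as ℤ using (ℤ; +_; -[1+_])
open import Data.Fin using (Fin; zero; suc; _≟_)
open import Data.Bool using (Bool; true; false; not)
open import Data.Product using (_×_; _,_; proj₁; proj₂; ∃)
open import Relation.Nullary using (¬_; Dec; yes; no)
open import Relation.Binary.PropositionalEquality using (_≡_)
open import Relation.Binary.Structures using (IsStrictTotalOrder)
open import Algebra.Structures using (IsCommutativeRing)
import Relation.Binary.Definitions

-- Ordered fields (the real numbers are one; Agda's stdlib has no ℝ, so
-- the statement is quantified over every ordered field).

record OrderedField (c ℓ : Level) : Set (Level.suc (c ⊔ ℓ)) where
  infixl 6 _+_ _-_
  infixl 7 _*_
  infix 4 _<_
  field
    Carrier : Set c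
    _+_ _*_ : Carrier → Carrier → Carrier
    -_      : Carrier → Carrier
    0# 1#   : Carrier
    _<_     : Carrier → Carrier → Set ℓ
    isCommutativeRing : IsCommutativeRing _≡_ _+_ _*_ -_ 0# 1#
    isStrictTotalOrder : IsStrictTotalOrder _≡_ _<_
    0<1     : 0# < 1#
    +-mono-< : ∀ {a b} c → a < b → a + c < b + c
    *-pos    : ∀ {a b} → 0# < a → 0# < b → 0# < a * b
    inverse  : ∀ a → ¬ (a ≡ 0#) → ∃ λ b → a * b ≡ 1#

  _-_ : Carrier → Carrier → Carrier
  a - b = a + (- b)

  fromℕ : ℕ → Carrier
  fromℕ ℕ.zero    = 0#
  fromℕ (ℕ.suc n) = 1# + fromℕ n

  fromℤ : ℤ → Carrier
  fromℤ (+ n)      = fromℕ n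
  fromℤ -[1+ n ]   = - fromℕ (ℕ.suc n)

  sumFin : ∀ {m} → (Fin m → Carrier) → Carrier
  sumFin {ℕ.zero}  g = 0#
  sumFin {ℕ.suc m} g = g zero + sumFin (λ i → g (suc i))

-- Finite graphs (loops and multiple edges allowed): vertices Fin n,
-- edges Fin m, each edge with an (unordered) pair of end-vertices,
-- recorded as a pair.

record Graph : Set where
  field
    nV nE : ℕ
    ends  : Fin nE → Fin nV × Fin nV

open Graph public

-- An orientation: for each edge, true means "from the first end to the
-- second end", false means the reverse.
Orientation : Graph → Set
Orientation G = Fin (nE G) → Bool

tail head : (G : Graph) → Orientation G → Fin (nE G) → Fin (nV G)
tail G ε e with ε e
... | true  = proj₁ (ends G e)
... | false = proj₂ (ends G e)
head G ε e with ε e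
... | true  = proj₂ (ends G e)
... | false = proj₁ (ends G e)

count : ∀ {m} → (Fin m → Bool) → ℕ
count {ℕ.zero}  p = 0
count {ℕ.suc m} p with p zero
... | true  = ℕ.suc (count (λ i → p (suc i)))
... | false = count (λ i → p (suc i))

isYes : ∀ {a} {A : Set a} → Dec A → Bool
isYes (yes _) = true
isYes (no _)  = false

_∧_ : Bool → Bool → Bool
true ∧ b = b
false ∧ b = false

-- Eulerian equivalence: the spanning subgraph on the edges where ε₁ and ε₂
-- differ, oriented by ε₁, has in-degree = out-degree at every vertex.
differ : (G : Graph) → Orientation G → Orientation G → Fin (nE G) → Bool
differ G ε₁ ε₂ e with ε₁ e | ε₂ e
... | true  | true  = false
... | false | false = false
... | _     | _     = true

EulerianEquivalent : (G : Graph) → Orientation G → Orientation G → Set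
EulerianEquivalent G ε₁ ε₂ =
  ∀ (v : Fin (nV G)) →
    count (λ e → differ G ε₁ ε₂ e ∧ isYes (tail G ε₁ e ≟ v))
    ≡ count (λ e → differ G ε₁ ε₂ e ∧ isYes (head G ε₁ e ≟ v))

module _ {c ℓ} (R : OrderedField c ℓ) where
  open OrderedField R

  -- ε(v,e) · x : +x if e leaves v, -x if e enters v, 0 for loops / non-incident
  incidence : (G : Graph) → Orientation G → Fin (nV G) → Fin (nE G) → Carrier → Carrier
  incidence G ε v e x with isYes (tail G ε e ≟ v) | isYes (head G ε e ≟ v)
  ... | true  | false = x
  ... | false | true  = - x
  ... | _     | _     = 0#

  IsQFlow : (G : Graph) → Orientation G → ℕ → (Fin (nE G) → Carrier) → Set (c ⊔ ℓ)
  IsQFlow G ε q f =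
    (∀ v → sumFin (λ e → incidence G ε v e (f e)) ≡ 0#)
    × (∀ e → (- fromℕ q < f e) × (f e < fromℕ q))

  orientBy : (G : Graph) → Orientation G → (Fin (nE G) → Carrier) → Orientation G
  orientBy G ε f e with IsStrictTotalOrder.compare isStrictTotalOrder 0# (f e)
  ... | Relation.Binary.Definitions.tri< _ _ _ = ε e
  ... | Relation.Binary.Definitions.tri≈ _ _ _ = not (ε e)
  ... | Relation.Binary.Definitions.tri> _ _ _ = not (ε e)

  CongMod : ℕ → Carrier → Carrier → Set c
  CongMod q x y = ∃ λ (k : ℤ) → x - y ≡ fromℤ k * fromℕ q

module Submission where

-- Let Q be q read in the field and fix a vertex v.  Each edge value lies in
-- (-Q, Q), so two values congruent modulo Q either coincide or differ by
-- exactly ±Q, and in the latter case exactly one of them is positive.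
-- Hence on every edge e either f₁ e = f₂ e (and ε_{f₁}, ε_{f₂} agree on e),
-- or f₁ e = f₂ e ± Q and e is reversed, oriented by ε_{f₁} as it is by ε
-- (sign +) or against ε (sign -).  In every case the outflow of f₁ at v
-- along e, plus Q if e is a reversed edge entering v under ε_{f₁}, equals
-- the outflow of f₂ at v along e, plus Q if e is a reversed edge leaving v.
-- Summing over the edges, the conservation laws of f₁ and f₂ leave
-- (#entering)·Q = (#leaving)·Q, and cancelling Q > 0 in the ordered field
-- gives the equality of counts that defines Eulerian equivalence.

open import Defs
open import Level using (_⊔_)
open import Data.Nat using (ℕ; NonZero; zero; suc)
open import Data.Fin using (Fin; _≟_)
open import Data.Integer using (ℤ; -[1+_])
import Data.Integer as ℤ
import Data.Fin as F
open import Data.Bool using (Bool; true; false; not; if_then_else_)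
open import Data.Bool.Properties using (not-involutive)
open import Data.Product using (_×_; _,_; proj₁; proj₂)
open import Data.Empty using (⊥-elim)
open import Relation.Nullary using (¬_; Dec; yes; no)
open import Relation.Binary.PropositionalEquality
open import Relation.Binary.Structures using (IsStrictTotalOrder)
open import Relation.Binary.Definitions using (tri<; tri≈; tri>)
open import Algebra.Bundles using (CommutativeRing)
open import Function using (_∘_)

tail-agree : ∀ G (σ τ : Orientation G) e → σ e ≡ τ e → tail G σ e ≡ tail G τ e
tail-agree G σ τ e p with σ e | τ e | p
... | true  | true  | _ = refl
... | false | false | _ = refl
... | true  | false | ()
... | false | true  | ()

head-agree : ∀ G (σ τ : Orientation G) e → σ e ≡ τ e → head G σ e ≡ head G τ e
head-agree G σ τ e p with σ e | τ e | p
... | true  | true  | _ = refl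
... | false | false | _ = refl
... | true  | false | ()
... | false | true  | ()

tail-flip : ∀ G (σ τ : Orientation G) e → σ e ≡ not (τ e) → tail G σ e ≡ head G τ e
tail-flip G σ τ e p with σ e | τ e | p
... | true  | false | _ = refl
... | false | true  | _ = refl
... | true  | true  | ()
... | false | false | ()

head-flip : ∀ G (σ τ : Orientation G) e → σ e ≡ not (τ e) → head G σ e ≡ tail G τ e
head-flip G σ τ e p with σ e | τ e | p
... | true  | false | _ = refl
... | false | true  | _ = refl
... | true  | true  | ()
... | false | false | ()

differ-agree : ∀ G (σ τ : Orientation G) e → σ e ≡ τ e → differ G σ τ e ≡ false
differ-agree G σ τ e p with σ e | τ e | p
... | true  | true  | _ = refl
... | false | false | _ = refl
... | true  | false | ()
... | false | true  | ()

differ-flip : ∀ G (σ τ : Orientation G) e → τ e ≡ not (σ e) → differ G σ τ e ≡ true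
differ-flip G σ τ e p with σ e | τ e | p
... | true  | false | _ = refl
... | false | true  | _ = refl
... | true  | true  | ()
... | false | false | ()

module Properties {c ℓ} (R : OrderedField c ℓ) where
  open OrderedField R
  private
    ring : CommutativeRing c c
    ring = record { isCommutativeRing = isCommutativeRing }
    module STO = IsStrictTotalOrder isStrictTotalOrder
  open CommutativeRing ring
    using (+-comm; +-assoc; +-identityˡ; +-identityʳ; -‿inverseˡ; -‿inverseʳ;
           zeroˡ; *-identityˡ; *-identityʳ; *-assoc; distribʳ)
  open import Algebra.Properties.Ring (CommutativeRing.ring ring)
    using (-‿involutive; -‿+-comm; -‿distribˡ-*; +-cancelˡ; x∙y⁻¹≈ε⇒x≈y; ⁻¹-anti-homo‿-)

  <-irrefl : ∀ {a} → ¬ (a < a)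
  <-irrefl = STO.irrefl refl

  <-asym : ∀ {a b} → a < b → ¬ (b < a)
  <-asym p q = <-irrefl (STO.trans p q)

  +-monoˡ-< : ∀ {a b} d → a < b → d + a < d + b
  +-monoˡ-< {a} {b} d p = subst₂ _<_ (+-comm a d) (+-comm b d) (+-mono-< d p)

  +-cancelˡ-< : ∀ {a b} d → d + a < d + b → a < b
  +-cancelˡ-< {a} {b} d p = subst₂ _<_ (cancel a) (cancel b) (+-monoˡ-< (- d) p)
    where
    cancel : ∀ x → - d + (d + x) ≡ x
    cancel x = trans (sym (+-assoc (- d) d x))
                     (trans (cong (_+ x) (-‿inverseˡ d)) (+-identityˡ x))

  +-mono₂-< : ∀ {a b d e} → a < b → d < e → a + d < b + e
  +-mono₂-< {a} {b} {d} p q = STO.trans (+-mono-< d p) (+-monoˡ-< b q)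

  neg-antitone : ∀ {a b} → a < b → - b < - a
  neg-antitone {a} {b} p = subst₂ _<_ left right (+-mono-< (- a + - b) p)
    where
    left : a + (- a + - b) ≡ - b
    left = trans (sym (+-assoc a (- a) (- b)))
                 (trans (cong (_+ - b) (-‿inverseʳ a)) (+-identityˡ (- b)))
    right : b + (- a + - b) ≡ - a
    right = trans (cong (b +_) (+-comm (- a) (- b)))
                  (trans (sym (+-assoc b (- b) (- a)))
                         (trans (cong (_+ - a) (-‿inverseʳ b)) (+-identityˡ (- a))))

  fromℕ-pos : ∀ n → 0# < fromℕ (suc n)
  fromℕ-pos zero    = subst (0# <_) (sym (+-identityʳ 1#)) 0<1
  fromℕ-pos (suc n) = STO.trans (fromℕ-pos n) (subst (_< 1# + fromℕ (suc n))
                        (+-identityˡ (fromℕ (suc n))) (+-mono-< (fromℕ (suc n)) 0<1))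

  multiple-nonneg : ∀ {Q} → 0# < Q → ∀ m → ¬ (fromℕ m * Q < 0#)
  multiple-nonneg {Q} _   zero    p = <-irrefl (subst (_< 0#) (zeroˡ Q) p)
  multiple-nonneg     Q>0 (suc m) p = <-asym p (*-pos (fromℕ-pos m) Q>0)

  fromℕ-injective : ∀ a b → fromℕ a ≡ fromℕ b → a ≡ b
  fromℕ-injective zero    zero    _ = refl
  fromℕ-injective zero    (suc b) p = ⊥-elim (<-irrefl (subst (0# <_) (sym p) (fromℕ-pos b)))
  fromℕ-injective (suc a) zero    p = ⊥-elim (<-irrefl (subst (0# <_) p (fromℕ-pos a)))
  fromℕ-injective (suc a) (suc b) p = cong suc (fromℕ-injective a b (+-cancelˡ 1# _ _ p))

  pos⇒nonzero : ∀ {a} → 0# < a → ¬ (a ≡ 0#)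
  pos⇒nonzero 0<a a≡0 = <-irrefl (subst (0# <_) a≡0 0<a)

  *-cancelʳ-nonzero : ∀ {Q} → ¬ (Q ≡ 0#) → ∀ a b → a * Q ≡ b * Q → a ≡ b
  *-cancelʳ-nonzero {Q} Q≢0 a b aQ≡bQ with inverse Q Q≢0
  ... | Q⁻¹ , QQ⁻¹≡1 = trans (sym (undo a)) (trans (cong (_* Q⁻¹) aQ≡bQ) (undo b))
    where
    undo : ∀ x → x * Q * Q⁻¹ ≡ x
    undo x = trans (*-assoc x Q Q⁻¹) (trans (cong (x *_) QQ⁻¹≡1) (*-identityʳ x))

  diff⇒sum : ∀ {x y z} → x - y ≡ z → x ≡ y + z
  diff⇒sum {x} {y} {z} p = begin
    x                ≡⟨ sym (+-identityʳ x) ⟩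
    x + 0#           ≡⟨ cong (x +_) (sym (-‿inverseˡ y)) ⟩
    x + (- y + y)    ≡⟨ sym (+-assoc x (- y) y) ⟩
    (x - y) + y      ≡⟨ cong (_+ y) p ⟩
    z + y            ≡⟨ +-comm z y ⟩
    y + z            ∎
    where open ≡-Reasoning

  neg-shift : ∀ y Q → - (y + Q) + Q ≡ - y + 0#
  neg-shift y Q = begin
    - (y + Q) + Q     ≡⟨ cong (_+ Q) (sym (-‿+-comm y Q)) ⟩
    (- y + - Q) + Q   ≡⟨ +-assoc (- y) (- Q) Q ⟩
    - y + (- Q + Q)   ≡⟨ cong (- y +_) (-‿inverseˡ Q) ⟩
    - y + 0#          ∎
    where open ≡-Reasoning

  unit-multiple : ∀ n {x y Q} → 0# < Q → x < Q → - Q < y →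
                  x - y ≡ fromℕ (suc n) * Q → x ≡ y + Q
  unit-multiple zero {Q = Q} _ _ _ p =
    diff⇒sum (trans p (trans (cong (_* Q) (+-identityʳ 1#)) (*-identityˡ Q)))
  unit-multiple (suc m) {x} {y} {Q} Q>0 x<Q -Q<y p =
    ⊥-elim (multiple-nonneg Q>0 m (+-cancelˡ-< Q (+-cancelˡ-< Q too-small)))
    where
    expand : fromℕ (suc (suc m)) * Q ≡ Q + (Q + fromℕ m * Q)
    expand = trans (distribʳ Q 1# (1# + fromℕ m))
               (cong₂ _+_ (*-identityˡ Q)
                 (trans (distribʳ Q 1# (fromℕ m)) (cong (_+ fromℕ m * Q) (*-identityˡ Q))))
    -- x - y < Q + Q, since x < Q and -y < Q
    too-small : Q + (Q + fromℕ m * Q) < Q + (Q + 0#)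
    too-small = subst₂ _<_ (trans p expand) (cong (Q +_) (sym (+-identityʳ Q)))
                  (+-mono₂-< x<Q (subst (- y <_) (-‿involutive Q) (neg-antitone -Q<y)))

  shift-signs : ∀ {x y Q} → x ≡ y + Q → x < Q → - Q < y → (0# < x) × ¬ (0# < y)
  shift-signs {x} {y} {Q} x≡y+Q x<Q -Q<y =
    subst₂ _<_ (-‿inverseˡ Q) (sym x≡y+Q) (+-mono-< Q -Q<y) ,
    λ 0<y → <-irrefl (STO.trans (subst₂ _<_ (+-identityˡ Q) (sym x≡y+Q) (+-mono-< Q 0<y)) x<Q)

  data Shift (x y Q : Carrier) : Set (c ⊔ ℓ) where
    no-shift   : x ≡ y → Shift x y Q
    shift-up   : x ≡ y + Q → 0# < x → ¬ (0# < y) → Shift x y Q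
    shift-down : y ≡ x + Q → ¬ (0# < x) → 0# < y → Shift x y Q

  swap-multiple : ∀ n {x y Q} → x - y ≡ fromℤ -[1+ n ] * Q → y - x ≡ fromℕ (suc n) * Q
  swap-multiple n {x} {y} {Q} p = begin
    y - x                         ≡⟨ sym (⁻¹-anti-homo‿- x y) ⟩
    - (x - y)                     ≡⟨ cong -_ p ⟩
    - (- fromℕ (suc n) * Q)       ≡⟨ cong -_ (sym (-‿distribˡ-* (fromℕ (suc n)) Q)) ⟩
    - - (fromℕ (suc n) * Q)       ≡⟨ -‿involutive (fromℕ (suc n) * Q) ⟩
    fromℕ (suc n) * Q             ∎
    where open ≡-Reasoning

  classify : ∀ {x y Q} → 0# < Q → - Q < x → x < Q → - Q < y → y < Q →
             (k : ℤ) → x - y ≡ fromℤ k * Q → Shift x y Q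
  classify {x} {y} {Q} _ _ _ _ _ (ℤ.+ zero) p =
    no-shift (x∙y⁻¹≈ε⇒x≈y x y (trans p (zeroˡ Q)))
  classify Q>0 _ x<Q -Q<y _ (ℤ.+ suc n) p =
    let x≡y+Q       = unit-multiple n Q>0 x<Q -Q<y p
        (0<x , y≯0) = shift-signs x≡y+Q x<Q -Q<y
    in shift-up x≡y+Q 0<x y≯0
  classify Q>0 -Q<x _ _ y<Q -[1+ n ] p =
    let y≡x+Q       = unit-multiple n Q>0 y<Q -Q<x (swap-multiple n p)
        (0<y , x≯0) = shift-signs y≡x+Q y<Q -Q<x
    in shift-down y≡x+Q x≯0 0<y

  positive? : ∀ a → Dec (0# < a)
  positive? a with STO.compare 0# a
  ... | tri< p _ _  = yes p
  ... | tri≈ ¬p _ _ = no ¬p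
  ... | tri> ¬p _ _ = no ¬p

  orientBy-pos : ∀ G ε (f : Fin (nE G) → Carrier) e → 0# < f e → orientBy R G ε f e ≡ ε e
  orientBy-pos G ε f e p with STO.compare 0# (f e)
  ... | tri< _ _ _   = refl
  ... | tri≈ ¬p _ _ = ⊥-elim (¬p p)
  ... | tri> ¬p _ _ = ⊥-elim (¬p p)

  orientBy-nonpos : ∀ G ε (f : Fin (nE G) → Carrier) e → ¬ (0# < f e) →
                    orientBy R G ε f e ≡ not (ε e)
  orientBy-nonpos G ε f e ¬p with STO.compare 0# (f e)
  ... | tri< p _ _ = ⊥-elim (¬p p)
  ... | tri≈ _ _ _ = refl
  ... | tri> _ _ _ = refl

  orientBy-cong : ∀ G ε (f g : Fin (nE G) → Carrier) e → f e ≡ g e →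
                  orientBy R G ε f e ≡ orientBy R G ε g e
  orientBy-cong G ε f g e p with positive? (f e)
  ... | yes 0<fe = trans (orientBy-pos G ε f e 0<fe)
                         (sym (orientBy-pos G ε g e (subst (0# <_) p 0<fe)))
  ... | no ¬0<fe = trans (orientBy-nonpos G ε f e ¬0<fe)
                         (sym (orientBy-nonpos G ε g e (¬0<fe ∘ subst (0# <_) (sym p))))

  incidence-shift : ∀ G ε v e y Q →
    incidence R G ε v e (y + Q) + (if isYes (head G ε e ≟ v) then Q else 0#)
    ≡ incidence R G ε v e y + (if isYes (tail G ε e ≟ v) then Q else 0#)
  incidence-shift G ε v e y Q with isYes (tail G ε e ≟ v) | isYes (head G ε e ≟ v)
  ... | true  | false = +-identityʳ (y + Q)
  ... | false | true  = neg-shift y Q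
  ... | true  | true  = refl
  ... | false | false = refl

  sumFin-cong : ∀ {m} {A B : Fin m → Carrier} → (∀ e → A e ≡ B e) → sumFin A ≡ sumFin B
  sumFin-cong {zero}  _ = refl
  sumFin-cong {suc m} p = cong₂ _+_ (p F.zero) (sumFin-cong (p ∘ F.suc))

  sumFin-+ : ∀ {m} (A B : Fin m → Carrier) → sumFin (λ e → A e + B e) ≡ sumFin A + sumFin B
  sumFin-+ {zero}  _ _ = sym (+-identityˡ 0#)
  sumFin-+ {suc m} A B = begin
    (a + b) + sumFin (λ i → A (F.suc i) + B (F.suc i)) ≡⟨ cong ((a + b) +_) (sumFin-+ (A ∘ F.suc) (B ∘ F.suc)) ⟩
    (a + b) + (sa + sb)                                ≡⟨ +-assoc a b (sa + sb) ⟩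
    a + (b + (sa + sb))                                ≡⟨ cong (a +_) (sym (+-assoc b sa sb)) ⟩
    a + ((b + sa) + sb)                                ≡⟨ cong (λ t → a + (t + sb)) (+-comm b sa) ⟩
    a + ((sa + b) + sb)                                ≡⟨ cong (a +_) (+-assoc sa b sb) ⟩
    a + (sa + (b + sb))                                ≡⟨ sym (+-assoc a sa (b + sb)) ⟩
    (a + sa) + (b + sb)                                ∎
    where
    open ≡-Reasoning
    a b sa sb : Carrier
    a = A F.zero
    b = B F.zero
    sa = sumFin (A ∘ F.suc)
    sb = sumFin (B ∘ F.suc)

  sumFin-count : ∀ {m} (p : Fin m → Bool) Q →
                 sumFin (λ e → if p e then Q else 0#) ≡ fromℕ (count p) * Q
  sumFin-count {zero}  p Q = sym (zeroˡ Q)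
  sumFin-count {suc m} p Q with p F.zero
  ... | true  = begin
    Q + sumFin (λ e → if p (F.suc e) then Q else 0#) ≡⟨ cong (Q +_) (sumFin-count (p ∘ F.suc) Q) ⟩
    Q + n * Q                                        ≡⟨ cong (_+ n * Q) (sym (*-identityˡ Q)) ⟩
    1# * Q + n * Q                                   ≡⟨ sym (distribʳ Q 1# n) ⟩
    (1# + n) * Q                                     ∎
    where
    open ≡-Reasoning
    n : Carrier
    n = fromℕ (count (p ∘ F.suc))
  ... | false = trans (+-identityˡ _) (sumFin-count (p ∘ F.suc) Q)

  module AtVertex (G : Graph) (ε : Orientation G) (f₁ f₂ : Fin (nE G) → Carrier)
                  (v : Fin (nV G)) (Q : Carrier) where
    σ₁ σ₂ : Orientation G
    σ₁ = orientBy R G ε f₁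
    σ₂ = orientBy R G ε f₂

    leaves enters : Fin (nE G) → Bool
    leaves e = differ G σ₁ σ₂ e ∧ isYes (tail G σ₁ e ≟ v)
    enters e = differ G σ₁ σ₂ e ∧ isYes (head G σ₁ e ≟ v)

    outflow : (Fin (nE G) → Carrier) → Fin (nE G) → Carrier
    outflow f e = incidence R G ε v e (f e)

    reversed-up : ∀ e → 0# < f₁ e → ¬ (0# < f₂ e) → σ₂ e ≡ not (σ₁ e)
    reversed-up e 0<f₁ f₂≯0 =
      trans (orientBy-nonpos G ε f₂ e f₂≯0) (cong not (sym (orientBy-pos G ε f₁ e 0<f₁)))

    reversed-down : ∀ e → ¬ (0# < f₁ e) → 0# < f₂ e → σ₂ e ≡ not (σ₁ e)
    reversed-down e f₁≯0 0<f₂ =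
      trans (orientBy-pos G ε f₂ e 0<f₂)
        (trans (sym (not-involutive (ε e))) (cong not (sym (orientBy-nonpos G ε f₁ e f₁≯0))))

    edge-balance : ∀ e → Shift (f₁ e) (f₂ e) Q →
      outflow f₁ e + (if enters e then Q else 0#) ≡ outflow f₂ e + (if leaves e then Q else 0#)
    edge-balance e (no-shift f₁≡f₂)
      rewrite differ-agree G σ₁ σ₂ e (orientBy-cong G ε f₁ f₂ e f₁≡f₂)
      = cong (λ x → incidence R G ε v e x + 0#) f₁≡f₂
    edge-balance e (shift-up f₁≡f₂+Q 0<f₁ f₂≯0)
      rewrite differ-flip G σ₁ σ₂ e (reversed-up e 0<f₁ f₂≯0)
            | tail-agree G σ₁ ε e (orientBy-pos G ε f₁ e 0<f₁)
            | head-agree G σ₁ ε e (orientBy-pos G ε f₁ e 0<f₁)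
            | f₁≡f₂+Q
      = incidence-shift G ε v e (f₂ e) Q
    edge-balance e (shift-down f₂≡f₁+Q f₁≯0 0<f₂)
      rewrite differ-flip G σ₁ σ₂ e (reversed-down e f₁≯0 0<f₂)
            | tail-flip G σ₁ ε e (orientBy-nonpos G ε f₁ e f₁≯0)
            | head-flip G σ₁ ε e (orientBy-nonpos G ε f₁ e f₁≯0)
            | f₂≡f₁+Q
      = sym (incidence-shift G ε v e (f₁ e) Q)

    -- Summing the edge balances, conservation at v cancels the outflows.
    vertex-balance : sumFin (outflow f₁) ≡ 0# → sumFin (outflow f₂) ≡ 0# →
                     (∀ e → Shift (f₁ e) (f₂ e) Q) →
                     fromℕ (count enters) * Q ≡ fromℕ (count leaves) * Q
    vertex-balance conserve₁ conserve₂ shift = begin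
      fromℕ (count enters) * Q
        ≡⟨ sym (+-identityˡ _) ⟩
      0# + fromℕ (count enters) * Q
        ≡⟨ cong₂ _+_ (sym conserve₁) (sym (sumFin-count enters Q)) ⟩
      sumFin (outflow f₁) + sumFin (λ e → if enters e then Q else 0#)
        ≡⟨ sym (sumFin-+ (outflow f₁) _) ⟩
      sumFin (λ e → outflow f₁ e + (if enters e then Q else 0#))
        ≡⟨ sumFin-cong (λ e → edge-balance e (shift e)) ⟩
      sumFin (λ e → outflow f₂ e + (if leaves e then Q else 0#))
        ≡⟨ sumFin-+ (outflow f₂) _ ⟩
      sumFin (outflow f₂) + sumFin (λ e → if leaves e then Q else 0#)
        ≡⟨ cong₂ _+_ conserve₂ (sumFin-count leaves Q) ⟩
      0# + fromℕ (count leaves) * Q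
        ≡⟨ +-identityˡ _ ⟩
      fromℕ (count leaves) * Q
        ∎
      where open ≡-Reasoning

lemma5p3 : ∀ {c ℓ} (R : OrderedField c ℓ) (G : Graph) (ε : Orientation G)
             (q : ℕ) → NonZero q →
             (f₁ f₂ : Fin (nE G) → OrderedField.Carrier R) →
             IsQFlow R G ε q f₁ → IsQFlow R G ε q f₂ →
             (∀ e → CongMod R q (f₁ e) (f₂ e)) →
             EulerianEquivalent G (orientBy R G ε f₁) (orientBy R G ε f₂)
lemma5p3 R G ε (suc n) _ f₁ f₂ (conserve₁ , bounded₁) (conserve₂ , bounded₂) congruent v =
  sym (fromℕ-injective (count enters) (count leaves)
        (*-cancelʳ-nonzero (pos⇒nonzero Q>0) _ _
          (vertex-balance (conserve₁ v) (conserve₂ v) shift)))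
  where
  open OrderedField R
  open Properties R
  Q : Carrier
  Q = fromℕ (suc n)
  Q>0 : 0# < Q
  Q>0 = fromℕ-pos n
  open AtVertex G ε f₁ f₂ v Q
  shift : ∀ e → Shift (f₁ e) (f₂ e) Q
  shift e = classify Q>0 (proj₁ (bounded₁ e)) (proj₂ (bounded₁ e))
                         (proj₁ (bounded₂ e)) (proj₂ (bounded₂ e))
                         (proj₁ (congruent e)) (proj₂ (congruent e))
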